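{- For the Prism allied graph $\mathbb{D}^{t}_{n}$ and every $n\ge 4$, $\operatorname{mdim}(\mathbb{D}^{t}_{n})=n+1$.
   Context: For an integer $n\ge 3$, the Prism allied graph $\mathbb{D}^{t}_{n}$ has vertex set $\{p_i,q_i,r_i,s_i : 1\le i\le n\}$ and edge set $\{p_iq_i,\ p_ip_{i+1},\ q_iq_{i+1},\ r_iq_i,\ r_iq_{i+1},\ r_is_i : 1\le i\le n\}$, with indices taken modulo $n$. For a connected graph $H$, $d_H(u,v)$ is the shortest-path distance, and for a vertex $x$ and an edge $e=uv$, $d_H(x,e)=\min\{d_H(x,u),d_H(x,v)\}$. A set $M\subseteq V(H)$ is a mixed metric generator of $H$ if for every two distinct elements $y_1,y_2\in V(H)\cup E(H)$ there is a vertex $z\in M$ with $d_H(z,y_1)\ne d_H(z,y_2)$. The mixed metric dimension $\operatorname{mdim}(H)$ is the minimum cardinality of a mixed metric generator of $H$. -}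

module Defs where

open import Data.Nat using (ℕ; zero; suc; _≤_; _⊓_)
open import Data.Fin using (Fin; zero; suc)
open import Data.Product using (_×_; _,_; Σ; ∃; ∃-syntax)
open import Data.Sum using (_⊎_; inj₁; inj₂)
open import Data.List using (List; length)
open import Data.List.Membership.Propositional using (_∈_)
open import Data.List.Relation.Unary.Unique.Propositional using (Unique)
open import Relation.Binary.PropositionalEquality using (_≡_; _≢_)

sucmod : ∀ {m} → Fin (suc m) → Fin (suc m)
sucmod {zero} zero = zero
sucmod {suc m} zero = suc zero
sucmod {suc m} (suc i) with sucmod {m} i
... | zero = zero
... | suc j = suc (suc j)

next : ∀ {n} → Fin n → Fin n
next {suc m} i = sucmod i

data Kind : Set where
  p q r s : Kind

Vertex : ℕ → Set
Vertex n = Kind × Fin n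

data EKind : Set where
  pq pp qq rq rq' rs : EKind

-- edge set: for n ≥ 3 these 6n labelled edges are pairwise distinct edges
Edge : ℕ → Set
Edge n = EKind × Fin n

endpoints : ∀ {n} → Edge n → Vertex n × Vertex n
endpoints (pq  , i) = (p , i) , (q , i)
endpoints (pp  , i) = (p , i) , (p , next i)
endpoints (qq  , i) = (q , i) , (q , next i)
endpoints (rq  , i) = (r , i) , (q , i)
endpoints (rq' , i) = (r , i) , (q , next i)
endpoints (rs  , i) = (r , i) , (s , i)

Adj : ∀ {n} → Vertex n → Vertex n → Set
Adj {n} u v = ∃[ e ] (endpoints {n} e ≡ (u , v) ⊎ endpoints {n} e ≡ (v , u))

data Walk {n : ℕ} : Vertex n → Vertex n → ℕ → Set where
  here : ∀ {u} → Walk u u 0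
  step : ∀ {u v w k} → Adj u v → Walk v w k → Walk u w (suc k)

Dist : ∀ {n} → Vertex n → Vertex n → ℕ → Set
Dist {n} u v d = Walk {n} u v d × (∀ k → Walk {n} u v k → d ≤ k)

Elem : ℕ → Set
Elem n = Vertex n ⊎ Edge n

DistElem : ∀ {n} → Vertex n → Elem n → ℕ → Set
DistElem z (inj₁ v) d = Dist z v d
DistElem {n} z (inj₂ e) d =
  let (a , b) = endpoints {n} e in
  ∃[ da ] ∃[ db ] (Dist z a da × Dist z b db × d ≡ da ⊓ db)

MixedMetricGenerator : ∀ n → List (Vertex n) → Set
MixedMetricGenerator n M =
  ∀ (y₁ y₂ : Elem n) → y₁ ≢ y₂ →
  ∃[ z ] (z ∈ M × ∃[ d₁ ] ∃[ d₂ ] (DistElem z y₁ d₁ × DistElem z y₂ d₂ × d₁ ≢ d₂))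

MixedMetricDim : ℕ → ℕ → Set
MixedMetricDim n k =
  (∃[ M ] (Unique M × length M ≡ k × MixedMetricGenerator n M))
  × (∀ (M : List (Vertex n)) → Unique M → MixedMetricGenerator n M → k ≤ length M)

-- Lower bound: a vertex other than s_i sees the edge r_i s_i at the same distance as r_i, so every
-- s_i belongs to a mixed metric generator; a vertex off the p-cycle sees p_0 q_0 at the same distance
-- as q_0, so some p-vertex belongs to it as well.
--
-- Upper bound: p_0 together with all s_i is a generator. Translate indices so that the first of two
-- elements sits at offset 3 from a base b. If the second sits at an offset at most 6, the distances
-- from s_{b+1}, …, s_{b+5}, capped at 4, can be read off an exploration of the graph around b on
-- symbolic vertices (kind, offset), and a finite computation shows that they tell the two elements
-- apart, except for the pair q_c, p_c q_c, which p_0 separates because it is strictly closer to p_c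
-- than to q_c. Otherwise s_{b+3} is within distance 3 of the first element and farther from the second.
-- The computation is carried out modulo N = min(n, 8), which is faithful on offsets below 8.

module Submission where

open import Defs
open import Data.Nat using (ℕ; zero; suc; _+_; _*_; _∸_; _⊓_; _≤_; _<_; z≤n; s≤s; NonZero)
open import Data.Nat.Properties
open import Data.Nat.DivMod
open import Data.Fin as Fin using (Fin; zero; suc; toℕ; fromℕ; inject₁)
open import Data.Fin.Properties using (toℕ-injective; toℕ<n; toℕ-fromℕ; toℕ-inject₁) renaming (any? to ∃-Fin?)
open import Data.Fin.Relation.Unary.Top using (view; ‵fromℕ; ‵inj₁)
open import Data.Product using (_×_; _,_; ∃; ∃-syntax; proj₁; proj₂; uncurry)
open import Data.Product.Properties using (≡-dec)
open import Data.Sum using (_⊎_; inj₁; inj₂; [_,_])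
import Data.Sum.Properties as Sum
open import Data.List using (List; []; _∷_; _++_; length; map; concatMap; allFin)
open import Data.List.Properties using (length-++; length-map; length-tabulate)
open import Data.List.Membership.Propositional using (_∈_; find; lose)
open import Data.List.Membership.Propositional.Properties
  using (∈-∃++; ∈-++⁻; ∈-++⁺ˡ; ∈-++⁺ʳ; ∈-map⁺; ∈-map⁻; ∈-allFin)
open import Data.List.Relation.Unary.All using (All; []; _∷_)
import Data.List.Relation.Unary.All as All
import Data.List.Relation.Unary.All.Properties as All
open import Data.List.Relation.Unary.Any using (Any; here; there)
import Data.List.Relation.Unary.Any as Any
import Data.List.Relation.Unary.Any.Properties as Any
open import Data.List.Relation.Unary.AllPairs using (_∷_)
open import Data.List.Relation.Unary.Unique.Propositional using (Unique)
import Data.List.Relation.Unary.Unique.Propositional.Properties as Unique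
open import Function using (_∘_; id)
open import Function.Bundles using (Equivalence; _⇔_; mk⇔; mk↣)
open import Function.Properties.Equivalence using () renaming (trans to ⇔-trans; sym to ⇔-sym)
open import Relation.Binary.Definitions using (DecidableEquality)
open import Relation.Binary.PropositionalEquality hiding ([_])
open import Relation.Nullary using (¬_; Dec; yes; no; ¬?; contradiction)
open import Relation.Nullary.Decidable using (map′; _×-dec_; _⊎-dec_; from-yes)
open import Relation.Unary using (Decidable)

-- Cyclic shifts of indices

[m%d+n]%d≡[m+n]%d : ∀ m n d .{{_ : NonZero d}} → (m % d + n) % d ≡ (m + n) % d
[m%d+n]%d≡[m+n]%d m n d = begin
  (m % d + n) % d         ≡⟨ %-distribˡ-+ (m % d) n d ⟩
  (m % d % d + n % d) % d ≡⟨ cong (λ t → (t + n % d) % d) (m%n%n≡m%n m d) ⟩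
  (m % d + n % d) % d     ≡⟨ %-distribˡ-+ m n d ⟨
  (m + n) % d             ∎
  where open ≡-Reasoning

%-congʳ-+ : ∀ a {m n} d .{{_ : NonZero d}} → m % d ≡ n % d → (a + m) % d ≡ (a + n) % d
%-congʳ-+ a {m} {n} d eq = begin
  (a + m) % d     ≡⟨ cong (_% d) (+-comm a m) ⟩
  (m + a) % d     ≡⟨ [m%d+n]%d≡[m+n]%d m a d ⟨
  (m % d + a) % d ≡⟨ cong (λ t → (t + a) % d) eq ⟩
  (n % d + a) % d ≡⟨ [m%d+n]%d≡[m+n]%d n a d ⟩
  (n + a) % d     ≡⟨ cong (_% d) (+-comm n a) ⟩
  (a + n) % d     ∎
  where open ≡-Reasoning

%-cancelˡ-+ : ∀ a m n d .{{_ : NonZero d}} → (a + m) % d ≡ (a + n) % d → m % d ≡ n % d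
%-cancelˡ-+ a m n d eq = begin
  m % d                           ≡⟨ undo m ⟩
  ((a + m) % d + (a * d ∸ a)) % d ≡⟨ cong (λ t → (t + (a * d ∸ a)) % d) eq ⟩
  ((a + n) % d + (a * d ∸ a)) % d ≡⟨ undo n ⟨
  n % d                           ∎
  where
  open ≡-Reasoning
  -- a * d ∸ a is congruent to −a
  undo : ∀ x → x % d ≡ ((a + x) % d + (a * d ∸ a)) % d
  undo x = begin
    x % d                           ≡⟨ [m+kn]%n≡m%n x a d ⟨
    (x + a * d) % d                 ≡⟨ cong (λ t → (x + t) % d) (m+[n∸m]≡n (m≤m*n a d)) ⟨
    (x + (a + (a * d ∸ a))) % d     ≡⟨ cong (_% d) (+-assoc x a (a * d ∸ a)) ⟨
    (x + a + (a * d ∸ a)) % d       ≡⟨ cong (λ t → (t + (a * d ∸ a)) % d) (+-comm x a) ⟩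
    (a + x + (a * d ∸ a)) % d       ≡⟨ [m%d+n]%d≡[m+n]%d (a + x) (a * d ∸ a) d ⟨
    ((a + x) % d + (a * d ∸ a)) % d ∎

%-≡⇔≡ : ∀ {m n d} .{{_ : NonZero d}} → m < d → n < d → m % d ≡ n % d ⇔ m ≡ n
%-≡⇔≡ m<d n<d rewrite m<n⇒m%n≡m m<d | m<n⇒m%n≡m n<d = mk⇔ id id

next-fromℕ : ∀ m → next (fromℕ m) ≡ zero
next-fromℕ zero    = refl
next-fromℕ (suc m) with sucmod {m} (fromℕ m) | next-fromℕ m
... | .zero | refl = refl

next-inject₁ : ∀ {m} (i : Fin m) → next (inject₁ i) ≡ suc i
next-inject₁ {suc m} zero    = refl
next-inject₁ {suc m} (suc i) with sucmod {m} (inject₁ i) | next-inject₁ i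
... | .(suc i) | refl = refl

toℕ-next : ∀ {m} (i : Fin (suc m)) → toℕ (next i) ≡ suc (toℕ i) % suc m
toℕ-next {m} i with view i
... | ‵fromℕ          rewrite next-fromℕ m | toℕ-fromℕ m   = sym (n%n≡0 (suc m))
... | ‵inj₁ {i = j} _ rewrite next-inject₁ j | toℕ-inject₁ j = sym (m<n⇒m%n≡m (s≤s (toℕ<n j)))

next-injective : ∀ {n} {x y : Fin n} → next x ≡ next y → x ≡ y
next-injective {suc m} {x} {y} eq = toℕ-injective (begin
  toℕ x         ≡⟨ m<n⇒m%n≡m (toℕ<n x) ⟨
  toℕ x % suc m ≡⟨ %-cancelˡ-+ 1 (toℕ x) (toℕ y) (suc m) (begin
                     suc (toℕ x) % suc m ≡⟨ toℕ-next x ⟨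
                     toℕ (next x)        ≡⟨ cong toℕ eq ⟩
                     toℕ (next y)        ≡⟨ toℕ-next y ⟩
                     suc (toℕ y) % suc m ∎) ⟩
  toℕ y % suc m ≡⟨ m<n⇒m%n≡m (toℕ<n y) ⟩
  toℕ y         ∎)
  where open ≡-Reasoning

next-surjective : ∀ {n} (c : Fin n) → ∃[ b ] next b ≡ c
next-surjective {suc m} zero    = fromℕ m , next-fromℕ m
next-surjective {suc m} (suc i) = inject₁ i , next-inject₁ i

shift : ∀ {n} → ℕ → Fin n → Fin n
shift zero    i = i
shift (suc o) i = next (shift o i)

toℕ-shift : ∀ {m} o (i : Fin (suc m)) → toℕ (shift o i) ≡ (toℕ i + o) % suc m
toℕ-shift {m} zero i = begin
  toℕ i               ≡⟨ m<n⇒m%n≡m (toℕ<n i) ⟨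
  toℕ i % suc m       ≡⟨ cong (_% suc m) (+-identityʳ (toℕ i)) ⟨
  (toℕ i + 0) % suc m ∎
  where open ≡-Reasoning
toℕ-shift {m} (suc o) i = begin
  toℕ (next (shift o i))            ≡⟨ toℕ-next (shift o i) ⟩
  suc (toℕ (shift o i)) % suc m     ≡⟨ cong (λ t → suc t % suc m) (toℕ-shift o i) ⟩
  (1 + (toℕ i + o) % suc m) % suc m ≡⟨ cong (_% suc m) (+-comm 1 _) ⟩
  ((toℕ i + o) % suc m + 1) % suc m ≡⟨ [m%d+n]%d≡[m+n]%d (toℕ i + o) 1 (suc m) ⟩
  (toℕ i + o + 1) % suc m           ≡⟨ cong (_% suc m) (trans (+-comm _ 1) (sym (+-suc (toℕ i) o))) ⟩
  (toℕ i + suc o) % suc m           ∎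
  where open ≡-Reasoning

shift-≡⇔ : ∀ {m} o o′ (b : Fin (suc m)) → shift o b ≡ shift o′ b ⇔ o % suc m ≡ o′ % suc m
shift-≡⇔ {m} o o′ b = mk⇔
  (λ eq → %-cancelˡ-+ (toℕ b) o o′ (suc m) (begin
    (toℕ b + o) % suc m  ≡⟨ toℕ-shift o b ⟨
    toℕ (shift o b)      ≡⟨ cong toℕ eq ⟩
    toℕ (shift o′ b)     ≡⟨ toℕ-shift o′ b ⟩
    (toℕ b + o′) % suc m ∎))
  (λ eq → toℕ-injective (begin
    toℕ (shift o b)      ≡⟨ toℕ-shift o b ⟩
    (toℕ b + o) % suc m  ≡⟨ %-congʳ-+ (toℕ b) (suc m) eq ⟩
    (toℕ b + o′) % suc m ≡⟨ toℕ-shift o′ b ⟨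
    toℕ (shift o′ b)     ∎))
  where open ≡-Reasoning

shift-surjective : ∀ {n} o (c : Fin n) → ∃[ b ] shift o b ≡ c
shift-surjective zero    c = c , refl
shift-surjective (suc o) c with next-surjective c
... | c′ , next-c′≡c with shift-surjective o c′
...   | b , shift-b≡c′ = b , trans (cong next shift-b≡c′) next-c′≡c

shift-toℕ : ∀ {m} (i : Fin (suc m)) → shift (toℕ i) zero ≡ i
shift-toℕ i = toℕ-injective (trans (toℕ-shift (toℕ i) zero) (m<n⇒m%n≡m (toℕ<n i)))

-- Walks and distances

retract⇒≟ : {A : Set} (code : A → ℕ) (decode : ℕ → A) → (∀ x → decode (code x) ≡ x) →
            DecidableEquality A
retract⇒≟ code decode decode-code = eq? (mk↣ λ {x} {y} e →
  trans (sym (decode-code x)) (trans (cong decode e) (decode-code y)))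

_≟ᴷ_ : DecidableEquality Kind
_≟ᴷ_ = retract⇒≟ code decode λ { p → refl ; q → refl ; r → refl ; s → refl }
  where
  code : Kind → ℕ
  code p = 0
  code q = 1
  code r = 2
  code s = 3
  decode : ℕ → Kind
  decode 0 = p
  decode 1 = q
  decode 2 = r
  decode _ = s

_≟ᴱ_ : DecidableEquality EKind
_≟ᴱ_ = retract⇒≟ code decode
  λ { pq → refl ; pp → refl ; qq → refl ; rq → refl ; rq' → refl ; rs → refl }
  where
  code : EKind → ℕ
  code pq  = 0
  code pp  = 1
  code qq  = 2
  code rq  = 3
  code rq' = 4
  code rs  = 5
  decode : ℕ → EKind
  decode 0 = pq
  decode 1 = pp
  decode 2 = qq
  decode 3 = rq
  decode 4 = rq'
  decode _ = rs

_≟ⱽ_ : ∀ {n} → DecidableEquality (Vertex n)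
_≟ⱽ_ = ≡-dec _≟ᴷ_ Fin._≟_

module Enumeration {A : Set} (xs : List A) (complete : ∀ x → x ∈ xs) where

  ∀? : {P : A → Set} → Decidable P → Dec (∀ x → P x)
  ∀? P? = map′ (λ all x → All.lookup all (complete x)) (λ f → All.tabulate (λ {x} _ → f x)) (All.all? P? xs)

  ∃? : {P : A → Set} → Decidable P → Dec (∃ P)
  ∃? P? = map′ Any.satisfied (λ (x , px) → Any.map (λ { refl → px }) (complete x)) (Any.any? P? xs)

kinds : List Kind
kinds = p ∷ q ∷ r ∷ s ∷ []

∈-kinds : ∀ k → k ∈ kinds
∈-kinds p = here refl
∈-kinds q = there (here refl)
∈-kinds r = there (there (here refl))
∈-kinds s = there (there (there (here refl)))

edgeKinds : List EKind
edgeKinds = pq ∷ pp ∷ qq ∷ rq ∷ rq' ∷ rs ∷ []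

∈-edgeKinds : ∀ e → e ∈ edgeKinds
∈-edgeKinds pq  = here refl
∈-edgeKinds pp  = there (here refl)
∈-edgeKinds qq  = there (there (here refl))
∈-edgeKinds rq  = there (there (there (here refl)))
∈-edgeKinds rq' = there (there (there (there (here refl))))
∈-edgeKinds rs  = there (there (there (there (there (here refl)))))

open Enumeration kinds ∈-kinds using () renaming (∀? to ∀-Kind?)
open Enumeration edgeKinds ∈-edgeKinds using () renaming (∀? to ∀-EKind?; ∃? to ∃-EKind?)

module _ {n : ℕ} where

  Adj-sym : {u v : Vertex n} → Adj u v → Adj v u
  Adj-sym (e , inj₁ eq) = e , inj₂ eq
  Adj-sym (e , inj₂ eq) = e , inj₁ eq

  edge-adj : (e : Edge n) → Adj (proj₁ (endpoints e)) (proj₂ (endpoints e))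
  edge-adj e = e , inj₁ refl

  _++ʷ_ : {u v w : Vertex n} {k l : ℕ} → Walk u v k → Walk v w l → Walk u w (k + l)
  here        ++ʷ walk′ = walk′
  step a walk ++ʷ walk′ = step a (walk ++ʷ walk′)

  snocʷ : {u v w : Vertex n} {k : ℕ} → Walk u v k → Adj v w → Walk u w (suc k)
  snocʷ here           a = step a here
  snocʷ (step a′ walk) a = step a′ (snocʷ walk a)

  reverseʷ : {u v : Vertex n} {k : ℕ} → Walk u v k → Walk v u k
  reverseʷ here          = here
  reverseʷ (step a walk) = snocʷ (reverseʷ walk) (Adj-sym a)

  unsnocʷ : {u v : Vertex n} {k : ℕ} → Walk u v (suc k) → ∃[ w ] (Walk u w k × Adj w v)
  unsnocʷ (step a here)           = _ , here , a
  unsnocʷ (step a (step a′ walk)) with unsnocʷ (step a′ walk)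
  ... | w , walk′ , a″ = w , step a walk′ , a″

  walk? : (u v : Vertex n) (k : ℕ) → Dec (Walk u v k)
  walk? u v zero    = map′ (λ { refl → here }) (λ { here → refl }) (u ≟ⱽ v)
  walk? u v (suc k) = map′ from to (∃-Edge? λ e →
    (proj₁ (endpoints e) ≟ⱽ u ×-dec walk? (proj₂ (endpoints e)) v k)
      ⊎-dec (proj₂ (endpoints e) ≟ⱽ u ×-dec walk? (proj₁ (endpoints e)) v k))
    where
    ∃-Edge? : {P : Edge n → Set} → Decidable P → Dec (∃ P)
    ∃-Edge? P? = map′ (λ { (e , i , Pei) → (e , i) , Pei }) (λ { ((e , i) , Pei) → e , i , Pei })
                      (∃-EKind? λ e → ∃-Fin? λ i → P? (e , i))
    FirstStep : Edge n → Set
    FirstStep e = (proj₁ (endpoints e) ≡ u × Walk (proj₂ (endpoints e)) v k)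
                ⊎ (proj₂ (endpoints e) ≡ u × Walk (proj₁ (endpoints e)) v k)
    from : ∃ FirstStep → Walk u v (suc k)
    from (e , inj₁ (refl , walk)) = step (e , inj₁ refl) walk
    from (e , inj₂ (refl , walk)) = step (e , inj₂ refl) walk
    to : Walk u v (suc k) → ∃ FirstStep
    to (step (e , inj₁ refl) walk) = e , inj₁ (refl , walk)
    to (step (e , inj₂ refl) walk) = e , inj₂ (refl , walk)

module _ {m : ℕ} where

  walk-along-q : ∀ k (i : Fin (suc m)) → Walk (q , i) (q , shift k i) k
  walk-along-q zero    i = here
  walk-along-q (suc k) i = snocʷ (walk-along-q k i) (edge-adj (qq , shift k i))

  walk-from-q₀ : (i : Fin (suc m)) → Walk (q , zero) (q , i) (toℕ i)
  walk-from-q₀ i = subst (λ t → Walk (q , zero) (q , t) (toℕ i)) (shift-toℕ i) (walk-along-q (toℕ i) zero)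

  walk-to-q : (v : Vertex (suc m)) → ∃[ k ] Walk v (q , proj₂ v) k
  walk-to-q (p , i) = 1 , step (edge-adj (pq , i)) here
  walk-to-q (q , i) = 0 , here
  walk-to-q (r , i) = 1 , step (edge-adj (rq , i)) here
  walk-to-q (s , i) = 2 , step (Adj-sym (edge-adj (rs , i))) (step (edge-adj (rq , i)) here)

  connected : (u v : Vertex (suc m)) → ∃ (Walk u v)
  connected u v =
    _ , (proj₂ (walk-to-q u) ++ʷ (reverseʷ (walk-from-q₀ (proj₂ u)) ++ʷ walk-from-q₀ (proj₂ v)))
        ++ʷ reverseʷ (proj₂ (walk-to-q v))

minimal : {P : ℕ → Set} → Decidable P → ∀ K → P K → ∃[ d ] (P d × (∀ k → P k → d ≤ k))
minimal P? zero    pK = 0 , pK , λ _ _ → z≤n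
minimal P? (suc K) pK with P? 0
... | yes p0 = 0 , p0 , λ _ _ → z≤n
... | no ¬p0 with minimal (λ k → P? (suc k)) K pK
...   | d , pd , least = suc d , pd , λ { zero p0 → contradiction p0 ¬p0 ; (suc k) pk → s≤s (least k pk) }

cappedLeast : {H : ℕ → Set} → Decidable H → ℕ → ℕ
cappedLeast H? R = proj₁ (minimal (λ j → H? j ⊎-dec (j ≟ suc R)) (suc R) (inj₂ refl))

cappedLeast-≡ : {H : ℕ → Set} (H? : Decidable H) (R d : ℕ) →
                (∀ j → j ≤ R → H j → d ≤ j) → (d ≤ R → H d) → cappedLeast H? R ≡ d ⊓ suc R
cappedLeast-≡ H? R d hit⇒d≤ d≤R⇒hit with minimal (λ j → H? j ⊎-dec (j ≟ suc R)) (suc R) (inj₂ refl)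
... | μ , Pμ , least = ≤-antisym upper (lower Pμ)
  where
  upper : μ ≤ d ⊓ suc R
  upper with d ≤? R
  ... | yes d≤R = subst (μ ≤_) (sym (m≤n⇒m⊓n≡m (m≤n⇒m≤1+n d≤R))) (least d (inj₁ (d≤R⇒hit d≤R)))
  ... | no  d≰R = subst (μ ≤_) (sym (m≥n⇒m⊓n≡n (≰⇒> d≰R))) (least (suc R) (inj₂ refl))
  lower : _ ⊎ μ ≡ suc R → d ⊓ suc R ≤ μ
  lower (inj₂ refl) = m⊓n≤n d (suc R)
  lower (inj₁ Hμ) with μ ≤? R
  ... | yes μ≤R = ≤-trans (m⊓n≤m d (suc R)) (hit⇒d≤ μ μ≤R Hμ)
  ... | no  μ≰R = ≤-trans (m⊓n≤n d (suc R)) (≰⇒> μ≰R)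

⊓-suc-≤ : ∀ {d R} → d ⊓ suc R ≤ R → d ≤ R
⊓-suc-≤ {d} {R} d⊓≤R with d ≤? R
... | yes d≤R = d≤R
... | no  d≰R = contradiction (subst (_≤ R) (m≥n⇒m⊓n≡n (≰⇒> d≰R)) d⊓≤R) (<-irrefl refl)

dist : ∀ {n} (u v : Vertex n) → ∃ (Dist u v)
dist {suc m} u v = minimal (walk? u v) _ (proj₂ (connected u v))

Dist-unique : ∀ {n} {u v : Vertex n} {d d′} → Dist u v d → Dist u v d′ → d ≡ d′
Dist-unique (walk , least) (walk′ , least′) = ≤-antisym (least _ walk′) (least′ _ walk)

distElem : ∀ {n} (z : Vertex n) (y : Elem n) → ∃ (DistElem z y)
distElem z (inj₁ v) = dist z v
distElem z (inj₂ e) with dist z (proj₁ (endpoints e)) | dist z (proj₂ (endpoints e))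
... | da , Da | db , Db = da ⊓ db , da , db , Da , Db , refl

Resolves : ∀ {n} → Vertex n → Elem n → Elem n → Set
Resolves z y₁ y₂ = ∃[ d₁ ] ∃[ d₂ ] (DistElem z y₁ d₁ × DistElem z y₂ d₂ × d₁ ≢ d₂)

resolves : ∀ {n} {z : Vertex n} {y₁ y₂} →
           (∀ {d₁ d₂} → DistElem z y₁ d₁ → DistElem z y₂ d₂ → d₁ ≢ d₂) → Resolves z y₁ y₂
resolves {z = z} {y₁} {y₂} apart with distElem z y₁ | distElem z y₂
... | d₁ , D₁ | d₂ , D₂ = d₁ , d₂ , D₁ , D₂ , apart D₁ D₂

Resolves-sym : ∀ {n} {z : Vertex n} {y₁ y₂} → Resolves z y₁ y₂ → Resolves z y₂ y₁
Resolves-sym (d₁ , d₂ , D₁ , D₂ , d₁≢d₂) = d₂ , d₁ , D₂ , D₁ , d₁≢d₂ ∘ sym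

module _ {n : ℕ} where

  Contraction : (Vertex n → Vertex n) → Set
  Contraction f = ∀ {u v} → Adj u v → f u ≡ f v ⊎ Adj (f u) (f v)

  contraction-by-edges : ∀ {f} → (∀ e → f (proj₁ (endpoints e)) ≡ f (proj₂ (endpoints e))
                                        ⊎ Adj (f (proj₁ (endpoints e))) (f (proj₂ (endpoints e)))) →
                         Contraction f
  contraction-by-edges f-edge (e , inj₁ refl) = f-edge e
  contraction-by-edges f-edge (e , inj₂ refl) with f-edge e
  ... | inj₁ eq = inj₁ (sym eq)
  ... | inj₂ a  = inj₂ (Adj-sym a)

  contract-walk : ∀ {f} → Contraction f → ∀ {u v k} → Walk u v k →
                  ∃[ k′ ] (k′ ≤ k × Walk (f u) (f v) k′)
  contract-walk f-contr here = 0 , z≤n , here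
  contract-walk {f} f-contr {v = v} (step a walk) with contract-walk f-contr walk | f-contr a
  ... | k′ , k′≤k , walk′ | inj₁ fu≡fw =
    k′ , m≤n⇒m≤1+n k′≤k , subst (λ t → Walk t (f v) k′) (sym fu≡fw) walk′
  ... | k′ , k′≤k , walk′ | inj₂ a′    = suc k′ , s≤s k′≤k , step a′ walk′

  contract-dist : ∀ {f} → Contraction f → ∀ {u v d d′} → Dist u v d → Dist (f u) (f v) d′ → d′ ≤ d
  contract-dist f-contr (walk , _) (_ , least′) with contract-walk f-contr walk
  ... | k′ , k′≤d , walk′ = ≤-trans (least′ k′ walk′) k′≤d

  onto-p : Vertex n → Vertex n
  onto-p (_ , i) = p , i

  onto-p-contraction : Contraction onto-p
  onto-p-contraction = contraction-by-edges λ where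
    (pq  , i) → inj₁ refl
    (pp  , i) → inj₂ (edge-adj (pp , i))
    (qq  , i) → inj₂ (edge-adj (pp , i))
    (rq  , i) → inj₁ refl
    (rq' , i) → inj₂ (edge-adj (pp , i))
    (rs  , i) → inj₁ refl

  p-onto-q : Vertex n → Vertex n
  p-onto-q (p , i) = q , i
  p-onto-q v       = v

  p-onto-q-contraction : Contraction p-onto-q
  p-onto-q-contraction = contraction-by-edges λ where
    (pq  , i) → inj₁ refl
    (pp  , i) → inj₂ (edge-adj (qq , i))
    (qq  , i) → inj₂ (edge-adj (qq , i))
    (rq  , i) → inj₂ (edge-adj (rq , i))
    (rq' , i) → inj₂ (edge-adj (rq' , i))
    (rs  , i) → inj₂ (edge-adj (rs , i))

  dist-q≤dist-p : ∀ {z : Vertex n} {j d d′} → proj₁ z ≢ p →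
                  Dist z (p , j) d → Dist z (q , j) d′ → d′ ≤ d
  dist-q≤dist-p {p , i} z≢p = contradiction refl z≢p
  dist-q≤dist-p {q , i} _   = contract-dist p-onto-q-contraction
  dist-q≤dist-p {r , i} _   = contract-dist p-onto-q-contraction
  dist-q≤dist-p {s , i} _   = contract-dist p-onto-q-contraction

  p-spoke : ∀ {i} {w : Vertex n} → Adj (p , i) w → proj₁ w ≢ p → w ≡ (q , i)
  p-spoke ((pq , _) , inj₁ refl) _   = refl
  p-spoke ((pp , _) , inj₁ refl) w≢p = contradiction refl w≢p
  p-spoke ((pp , _) , inj₂ refl) w≢p = contradiction refl w≢p

  -- the first step off the p-cycle is a spoke p_i q_i, which onto-p collapses
  leave-p-cycle : ∀ {u v : Vertex n} {k} → Walk u v k → proj₁ u ≡ p → proj₁ v ≢ p →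
                  ∃[ k′ ] (k′ < k × Walk (onto-p u) (onto-p v) k′)
  leave-p-cycle here refl v≢p = contradiction refl v≢p
  leave-p-cycle {p , i} {v} (step {v = w} a walk) refl v≢p with proj₁ w ≟ᴷ p
  ... | no w≢p with p-spoke a w≢p
  ...   | refl with contract-walk onto-p-contraction walk
  ...     | k′ , k′≤k , walk′ = k′ , s≤s k′≤k , walk′
  leave-p-cycle {p , i} {v} (step {v = w} a walk) refl v≢p | yes w≡p
    with leave-p-cycle walk w≡p v≢p | onto-p-contraction a
  ... | k′ , k′<k , walk′ | inj₁ eq =
    k′ , m<n⇒m<1+n k′<k , subst (λ t → Walk t (onto-p v) k′) (sym eq) walk′
  ... | k′ , k′<k , walk′ | inj₂ a′ = suc k′ , s≤s k′<k , step a′ walk′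

  dist-p<dist-q : ∀ {x j : Fin n} {d d′} → Dist (p , x) (p , j) d → Dist (p , x) (q , j) d′ → d < d′
  dist-p<dist-q (_ , least) (walk , _) with leave-p-cycle walk refl (λ ())
  ... | k′ , k′<d′ , walk′ = ≤-<-trans (least k′ walk′) k′<d′

  s-leaf : ∀ {i} {w : Vertex n} → Adj (s , i) w → w ≡ (r , i)
  s-leaf ((rs  , _) , inj₂ refl) = refl
  s-leaf ((pq  , _) , inj₁ ())
  s-leaf ((pp  , _) , inj₁ ())
  s-leaf ((qq  , _) , inj₁ ())
  s-leaf ((rq  , _) , inj₁ ())
  s-leaf ((rq' , _) , inj₁ ())
  s-leaf ((rs  , _) , inj₁ ())
  s-leaf ((pq  , _) , inj₂ ())
  s-leaf ((pp  , _) , inj₂ ())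
  s-leaf ((qq  , _) , inj₂ ())
  s-leaf ((rq  , _) , inj₂ ())
  s-leaf ((rq' , _) , inj₂ ())

  dist-r<dist-s : ∀ {z : Vertex n} {i d d′} → z ≢ (s , i) → Dist z (r , i) d → Dist z (s , i) d′ → d < d′
  dist-r<dist-s z≢s (_ , least) (walk , _) with reverseʷ walk
  ... | here = contradiction refl z≢s
  ... | step a walk′ with s-leaf a
  ...   | refl = s≤s (least _ (reverseʷ walk′))

  p-resolves-twins : ∀ (x c : Fin n) → Resolves (p , x) (inj₁ (q , c)) (inj₂ (pq , c))
  p-resolves-twins x c = resolves {z = p , x} {inj₁ (q , c)} {inj₂ (pq , c)} λ where
    D₁ (_ , _ , Da , Db , refl) d₁≡d₂ →
      <⇒≢ (dist-p<dist-q Da Db)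
          (sym (trans (Dist-unique Db D₁) (trans d₁≡d₂ (m≤n⇒m⊓n≡m (<⇒≤ (dist-p<dist-q Da Db))))))

-- Lower bound

Unique-⊆⇒length≤ : {A : Set} {xs ys : List A} → Unique xs → (∀ {x} → x ∈ xs → x ∈ ys) →
                   length xs ≤ length ys
Unique-⊆⇒length≤ {xs = []}     _             _     = z≤n
Unique-⊆⇒length≤ {xs = x ∷ xs} (x∉xs ∷ uniq) xs⊆ys with ∈-∃++ (xs⊆ys (here refl))
... | ys₁ , ys₂ , refl = begin
  suc (length xs)               ≤⟨ s≤s (Unique-⊆⇒length≤ uniq xs⊆ys₁++ys₂) ⟩
  suc (length (ys₁ ++ ys₂))     ≡⟨ cong suc (length-++ ys₁) ⟩
  suc (length ys₁ + length ys₂) ≡⟨ +-suc (length ys₁) (length ys₂) ⟨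
  length ys₁ + suc (length ys₂) ≡⟨ length-++ ys₁ ⟨
  length (ys₁ ++ x ∷ ys₂)       ∎
  where
  open ≤-Reasoning
  xs⊆ys₁++ys₂ : ∀ {y} → y ∈ xs → y ∈ ys₁ ++ ys₂
  xs⊆ys₁++ys₂ y∈xs with ∈-++⁻ ys₁ (xs⊆ys (there y∈xs))
  ... | inj₁ y∈ys₁         = ∈-++⁺ˡ y∈ys₁
  ... | inj₂ (here refl)   = contradiction refl (All.lookup x∉xs y∈xs)
  ... | inj₂ (there y∈ys₂) = ∈-++⁺ʳ ys₁ y∈ys₂

sVertices : ∀ n → List (Vertex n)
sVertices n = map (s ,_) (allFin n)

sVertices-unique : ∀ n → Unique (sVertices n)
sVertices-unique n = Unique.map⁺ (λ { refl → refl }) (Unique.allFin⁺ n)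

length-sVertices : ∀ n → length (sVertices n) ≡ n
length-sVertices n = trans (length-map (λ (i : Fin n) → (s , i)) (allFin n)) (length-tabulate {n = n} id)

∈-sVertices : ∀ {n} (i : Fin n) → (s , i) ∈ sVertices n
∈-sVertices i = ∈-map⁺ (s ,_) (∈-allFin i)

sVertices-kind : ∀ {n} {v : Vertex n} → v ∈ sVertices n → proj₁ v ≡ s
sVertices-kind v∈ with ∈-map⁻ (s ,_) v∈
... | _ , _ , refl = refl

module _ {n : ℕ} where

  r-rs-unresolved : ∀ {z : Vertex n} {i} → z ≢ (s , i) → ¬ Resolves z (inj₁ (r , i)) (inj₂ (rs , i))
  r-rs-unresolved z≢s (_ , _ , D₁ , (_ , _ , Da , Db , refl) , d₁≢d₂) =
    d₁≢d₂ (trans (Dist-unique D₁ Da) (sym (m≤n⇒m⊓n≡m (<⇒≤ (dist-r<dist-s z≢s Da Db)))))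

  q-pq-unresolved : ∀ {z : Vertex n} {j} → proj₁ z ≢ p → ¬ Resolves z (inj₁ (q , j)) (inj₂ (pq , j))
  q-pq-unresolved z≢p (_ , _ , D₁ , (_ , _ , Da , Db , refl) , d₁≢d₂) =
    d₁≢d₂ (trans (Dist-unique D₁ Db) (sym (m≥n⇒m⊓n≡n (dist-q≤dist-p z≢p Da Db))))

  s-vertices-needed : ∀ {M} → MixedMetricGenerator n M → ∀ i → (s , i) ∈ M
  s-vertices-needed gen i with gen (inj₁ (r , i)) (inj₂ (rs , i)) (λ ())
  ... | z , z∈M , res with z ≟ⱽ (s , i)
  ...   | yes refl = z∈M
  ...   | no z≢s   = contradiction res (r-rs-unresolved z≢s)

  p-vertex-needed : ∀ {M} → Fin n → MixedMetricGenerator n M → ∃[ z ] (z ∈ M × proj₁ z ≡ p)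
  p-vertex-needed j gen with gen (inj₁ (q , j)) (inj₂ (pq , j)) (λ ())
  ... | z , z∈M , res with proj₁ z ≟ᴷ p
  ...   | yes z≡p = z , z∈M , z≡p
  ...   | no z≢p  = contradiction res (q-pq-unresolved z≢p)

  generator-size : ∀ {M} → Fin n → Unique M → MixedMetricGenerator n M → suc n ≤ length M
  generator-size {M} j _ gen with p-vertex-needed j gen
  ... | z , z∈M , z≡p = subst (_≤ length M) (cong suc (length-sVertices n))
          (Unique-⊆⇒length≤ (All.tabulate z≢sVertex ∷ sVertices-unique n) z∷sVertices⊆M)
    where
    z≢sVertex : ∀ {v} → v ∈ sVertices n → z ≢ v
    z≢sVertex v∈ refl with trans (sym z≡p) (sVertices-kind v∈)
    ... | ()
    z∷sVertices⊆M : ∀ {v} → v ∈ z ∷ sVertices n → v ∈ M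
    z∷sVertices⊆M (here refl) = z∈M
    z∷sVertices⊆M (there v∈) with ∈-map⁻ (s ,_) v∈
    ... | i , _ , refl = s-vertices-needed gen i

-- Symbolic exploration around a base index

SVertex : Set
SVertex = Kind × ℕ

offset : SVertex → ℕ
offset = proj₂

-- Backward neighbours are listed only at positive offsets, so every listed neighbour is genuine;
-- the list is complete at positive offsets.
neighbours : SVertex → List SVertex
neighbours (p , zero)  = (q , 0) ∷ (p , 1) ∷ []
neighbours (p , suc o) = (q , suc o) ∷ (p , suc (suc o)) ∷ (p , o) ∷ []
neighbours (q , zero)  = (p , 0) ∷ (q , 1) ∷ (r , 0) ∷ []
neighbours (q , suc o) = (p , suc o) ∷ (q , suc (suc o)) ∷ (r , suc o) ∷ (q , o) ∷ (r , o) ∷ []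
neighbours (r , o)     = (q , o) ∷ (q , suc o) ∷ (s , o) ∷ []
neighbours (s , o)     = (r , o) ∷ []

layer : SVertex → ℕ → List SVertex
layer x zero    = x ∷ []
layer x (suc j) = concatMap neighbours (layer x j)

ElemKind : Set
ElemKind = Kind ⊎ EKind

ends : EKind → ℕ → SVertex × SVertex
ends pq  o = (p , o) , (q , o)
ends pp  o = (p , o) , (p , suc o)
ends qq  o = (q , o) , (q , suc o)
ends rq  o = (r , o) , (q , o)
ends rq' o = (r , o) , (q , suc o)
ends rs  o = (r , o) , (s , o)

element : ∀ {n} → ElemKind → Fin n → Elem n
element (inj₁ k) i = inj₁ (k , i)
element (inj₂ e) i = inj₂ (e , i)

kindOf : ∀ {n} → Elem n → ElemKind
kindOf (inj₁ (k , _)) = inj₁ k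
kindOf (inj₂ (e , _)) = inj₂ e

indexOf : ∀ {n} → Elem n → Fin n
indexOf (inj₁ (_ , i)) = i
indexOf (inj₂ (_ , i)) = i

element-kindOf-indexOf : ∀ {n} (y : Elem n) → element (kindOf y) (indexOf y) ≡ y
element-kindOf-indexOf (inj₁ _) = refl
element-kindOf-indexOf (inj₂ _) = refl

module Interpretation {n : ℕ} (b : Fin n) where

  ⟦_⟧ : SVertex → Vertex n
  ⟦ k , o ⟧ = k , shift o b

  neighbours-adjacent : ∀ x → All (λ y → Adj ⟦ x ⟧ ⟦ y ⟧) (neighbours x)
  neighbours-adjacent (p , zero)  = ((pq , _) , inj₁ refl) ∷ ((pp , _) , inj₁ refl) ∷ []
  neighbours-adjacent (p , suc o) = ((pq , _) , inj₁ refl) ∷ ((pp , _) , inj₁ refl) ∷ ((pp , _) , inj₂ refl) ∷ []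
  neighbours-adjacent (q , zero)  = ((pq , _) , inj₂ refl) ∷ ((qq , _) , inj₁ refl) ∷ ((rq , _) , inj₂ refl) ∷ []
  neighbours-adjacent (q , suc o) = ((pq , _) , inj₂ refl) ∷ ((qq , _) , inj₁ refl) ∷ ((rq , _) , inj₂ refl)
                                    ∷ ((qq , _) , inj₂ refl) ∷ ((rq' , _) , inj₂ refl) ∷ []
  neighbours-adjacent (r , o)     = ((rq , _) , inj₁ refl) ∷ ((rq' , _) , inj₁ refl) ∷ ((rs , _) , inj₁ refl) ∷ []
  neighbours-adjacent (s , o)     = ((rs , _) , inj₂ refl) ∷ []

  adjacent-neighbour : ∀ {x v} → 0 < offset x → Adj ⟦ x ⟧ v → Any (λ y → v ≡ ⟦ y ⟧) (neighbours x)
  adjacent-neighbour {_ , suc o} _ ((pq  , _) , inj₁ refl) = here refl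
  adjacent-neighbour {_ , suc o} _ ((pp  , _) , inj₁ refl) = there (here refl)
  adjacent-neighbour {_ , suc o} _ ((qq  , _) , inj₁ refl) = there (here refl)
  adjacent-neighbour {_ , suc o} _ ((rq  , _) , inj₁ refl) = here refl
  adjacent-neighbour {_ , suc o} _ ((rq' , _) , inj₁ refl) = there (here refl)
  adjacent-neighbour {_ , suc o} _ ((rs  , _) , inj₁ refl) = there (there (here refl))
  adjacent-neighbour {_ , suc o} _ ((pq  , _) , inj₂ refl) = here refl
  adjacent-neighbour {_ , suc o} _ ((rq  , _) , inj₂ refl) = there (there (here refl))
  adjacent-neighbour {_ , suc o} _ ((rs  , _) , inj₂ refl) = here refl
  adjacent-neighbour {_ , suc o} _ ((pp  , _) , inj₂ eq) with next-injective (cong (proj₂ ∘ proj₂) eq)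
  ... | refl with eq
  ...   | refl = there (there (here refl))
  adjacent-neighbour {_ , suc o} _ ((qq  , _) , inj₂ eq) with next-injective (cong (proj₂ ∘ proj₂) eq)
  ... | refl with eq
  ...   | refl = there (there (there (here refl)))
  adjacent-neighbour {_ , suc o} _ ((rq' , _) , inj₂ eq) with next-injective (cong (proj₂ ∘ proj₂) eq)
  ... | refl with eq
  ...   | refl = there (there (there (there (here refl))))

  layer-walk : ∀ x j → All (λ y → Walk ⟦ x ⟧ ⟦ y ⟧ j) (layer x j)
  layer-walk x zero    = here ∷ []
  layer-walk x (suc j) = All.concat⁺ (All.map⁺ (All.map extend (layer-walk x j)))
    where
    extend : ∀ {y} → Walk ⟦ x ⟧ ⟦ y ⟧ j → All (λ y′ → Walk ⟦ x ⟧ ⟦ y′ ⟧ (suc j)) (neighbours y)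
    extend {y} walk = All.map (snocʷ walk) (neighbours-adjacent y)

  walk-layer : ∀ x j {v} → (∀ {i} → i < j → All (λ y → 0 < offset y) (layer x i)) →
               Walk ⟦ x ⟧ v j → Any (λ y → v ≡ ⟦ y ⟧) (layer x j)
  walk-layer x zero    _        here = here refl
  walk-layer x (suc j) positive walk with unsnocʷ walk
  ... | w , walk′ , a with find (walk-layer x j (positive ∘ m<n⇒m<1+n) walk′)
  ...   | y , y∈layer , refl =
    Any.concatMap⁺ neighbours (lose y∈layer (adjacent-neighbour (All.lookup (positive ≤-refl) y∈layer) a))

WellPlaced : SVertex → ℕ → Set
WellPlaced x R = (∀ {j} → j < R → All (λ y → 0 < offset y) (layer x j))
               × (∀ {j} → j < suc R → All (λ y → offset y < 8) (layer x j))

wellPlaced? : ∀ x R → Dec (WellPlaced x R)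
wellPlaced? x R = allUpTo? (λ j → All.all? (λ y → 0 <? offset y) (layer x j)) R
            ×-dec allUpTo? (λ j → All.all? (λ y → offset y <? 8) (layer x j)) (suc R)

centres-well-placed : ∀ {c} → c < 5 → WellPlaced (s , suc c) 3
centres-well-placed = from-yes (allUpTo? (λ c → wellPlaced? (s , suc c) 3) 5)

s₃-well-placed : WellPlaced (s , 3) 3
s₃-well-placed = centres-well-placed {2} (m≤m+n 3 2)

s₃-ball-window : ∀ {j} → j < 4 → All (λ y → 2 ≤ offset y × offset y ≤ 5) (layer (s , 3) j)
s₃-ball-window =
  from-yes (allUpTo? (λ j → All.all? (λ y → 2 ≤? offset y ×-dec offset y ≤? 5) (layer (s , 3) j)) 4)

_≟ᴱᴷ_ : DecidableEquality ElemKind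
_≟ᴱᴷ_ = Sum.≡-dec _≟ᴷ_ _≟ᴱ_

∀-ElemKind? : {P : ElemKind → Set} → Decidable P → Dec (∀ k → P k)
∀-ElemKind? P? = map′ (uncurry [_,_]) (λ h → h ∘ inj₁ , h ∘ inj₂)
                      (∀-Kind? (P? ∘ inj₁) ×-dec ∀-EKind? (P? ∘ inj₂))

Twins : ElemKind → ElemKind → Set
Twins k k′ = (k ≡ inj₁ q × k′ ≡ inj₂ pq) ⊎ (k ≡ inj₂ pq × k′ ≡ inj₁ q)

twins? : ∀ k k′ → Dec (Twins k k′)
twins? k k′ = ((k ≟ᴱᴷ inj₁ q) ×-dec (k′ ≟ᴱᴷ inj₂ pq))
        ⊎-dec ((k ≟ᴱᴷ inj₂ pq) ×-dec (k′ ≟ᴱᴷ inj₁ q))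

module Modulo (N : ℕ) .{{_ : NonZero N}} where

  _≈_ : SVertex → SVertex → Set
  (k , o) ≈ (k′ , o′) = k ≡ k′ × o % N ≡ o′ % N

  _≈?_ : ∀ x y → Dec (x ≈ y)
  (k , o) ≈? (k′ , o′) = (k ≟ᴷ k′) ×-dec (o % N ≟ o′ % N)

  capDist : ℕ → SVertex → SVertex → ℕ
  capDist R x t = cappedLeast (λ j → Any.any? (t ≈?_) (layer x j)) R

  capDistElem : ℕ → SVertex → ElemKind → ℕ → ℕ
  capDistElem R x (inj₁ k) o = capDist R x (k , o)
  capDistElem R x (inj₂ e) o = capDist R x (proj₁ (ends e o)) ⊓ capDist R x (proj₂ (ends e o))

  Separated : ElemKind → ElemKind → ℕ → Set
  Separated k₁ k₂ o = (3 % N ≡ o % N × (k₁ ≡ k₂ ⊎ Twins k₁ k₂))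
                    ⊎ ∃[ c ] (c < 5 × capDistElem 3 (s , suc c) k₁ 3 ≢ capDistElem 3 (s , suc c) k₂ o)

  separated? : ∀ k₁ k₂ o → Dec (Separated k₁ k₂ o)
  separated? k₁ k₂ o = ((3 % N ≟ o % N) ×-dec ((k₁ ≟ᴱᴷ k₂) ⊎-dec twins? k₁ k₂))
    ⊎-dec anyUpTo? (λ c → ¬? (capDistElem 3 (s , suc c) k₁ 3 ≟ capDistElem 3 (s , suc c) k₂ o)) 5

  record Certificate : Set where
    constructor certificate
    field
      near      : ∀ k → capDistElem 3 (s , 3) k 3 ≤ 3
      separated : ∀ k₁ k₂ {o} → o < 7 → Separated k₁ k₂ o

  certificate? : Dec Certificate
  certificate? = map′ (uncurry certificate) (λ cert → Certificate.near cert , Certificate.separated cert)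
    (∀-ElemKind? (λ k → capDistElem 3 (s , 3) k 3 ≤? 3)
      ×-dec ∀-ElemKind? λ k₁ → ∀-ElemKind? λ k₂ → allUpTo? (separated? k₁ k₂) 7)

-- Soundness of the symbolic computation

Agrees : (n N : ℕ) .{{_ : NonZero n}} .{{_ : NonZero N}} → Set
Agrees n N = ∀ {o o′} → o < 8 → o′ < 8 → o % N ≡ o′ % N ⇔ o % n ≡ o′ % n

agrees-with-itself : ∀ n .{{_ : NonZero n}} → Agrees n n
agrees-with-itself n _ _ = mk⇔ id id

agrees-with-8 : ∀ {n} .{{_ : NonZero n}} → 8 ≤ n → Agrees n 8
agrees-with-8 8≤n o<8 o′<8 =
  ⇔-trans (%-≡⇔≡ o<8 o′<8) (⇔-sym (%-≡⇔≡ (<-≤-trans o<8 8≤n) (<-≤-trans o′<8 8≤n)))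

module Soundness {m : ℕ} (b : Fin (suc m)) (N : ℕ) .{{_ : NonZero N}} (agree : Agrees (suc m) N) where

  open Interpretation b
  open Modulo N

  shift-≈ : ∀ {o o′} → o < 8 → o′ < 8 → o % N ≡ o′ % N → shift o b ≡ shift o′ b
  shift-≈ {o} {o′} o<8 o′<8 = Equivalence.from (shift-≡⇔ o o′ b) ∘ Equivalence.to (agree o<8 o′<8)

  ≈⇔⟦⟧≡ : ∀ {x y} → offset x < 8 → offset y < 8 → x ≈ y ⇔ ⟦ x ⟧ ≡ ⟦ y ⟧
  ≈⇔⟦⟧≡ {k , o} {k′ , o′} o<8 o′<8 = mk⇔
    (λ (k≡k′ , o≈o′) → cong₂ _,_ k≡k′ (shift-≈ o<8 o′<8 o≈o′))
    (λ eq → cong proj₁ eq ,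
            Equivalence.from (agree o<8 o′<8) (Equivalence.to (shift-≡⇔ o o′ b) (cong proj₂ eq)))

  capDist-sound : ∀ {x t R d} → WellPlaced x R → offset t < 8 → Dist ⟦ x ⟧ ⟦ t ⟧ d →
                  capDist R x t ≡ d ⊓ suc R
  capDist-sound {x} {t} {R} {d} (positive , bounded) t<8 (walk , least) =
    cappedLeast-≡ (λ j → Any.any? (t ≈?_) (layer x j)) R d hit⇒d≤ d≤R⇒hit
    where
    hit⇒d≤ : ∀ j → j ≤ R → Any (t ≈_) (layer x j) → d ≤ j
    hit⇒d≤ j j≤R hit with find hit
    ... | y , y∈layer , t≈y with Equivalence.to (≈⇔⟦⟧≡ t<8 (All.lookup (bounded (s≤s j≤R)) y∈layer)) t≈y
    ...   | ⟦t⟧≡⟦y⟧ =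
      least j (subst (λ v → Walk ⟦ x ⟧ v j) (sym ⟦t⟧≡⟦y⟧) (All.lookup (layer-walk x j) y∈layer))
    d≤R⇒hit : d ≤ R → Any (t ≈_) (layer x d)
    d≤R⇒hit d≤R with find (walk-layer x d (λ i<d → positive (<-≤-trans i<d d≤R)) walk)
    ... | y , y∈layer , ⟦t⟧≡⟦y⟧ =
      lose y∈layer (Equivalence.from (≈⇔⟦⟧≡ t<8 (All.lookup (bounded (s≤s d≤R)) y∈layer)) ⟦t⟧≡⟦y⟧)

  capDist-⊓-sound : ∀ {x t t′ R da db} → WellPlaced x R → offset t < 8 → offset t′ < 8 →
                    Dist ⟦ x ⟧ ⟦ t ⟧ da → Dist ⟦ x ⟧ ⟦ t′ ⟧ db →
                    capDist R x t ⊓ capDist R x t′ ≡ (da ⊓ db) ⊓ suc R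
  capDist-⊓-sound {R = R} {da} {db} wp t<8 t′<8 Da Db =
    trans (cong₂ _⊓_ (capDist-sound wp t<8 Da) (capDist-sound wp t′<8 Db))
          (sym (mono-≤-distrib-⊓ (⊓-monoˡ-≤ (suc R)) da db))

  capDistElem-sound : ∀ {x R k o d} → WellPlaced x R → o < 7 →
                      DistElem ⟦ x ⟧ (element k (shift o b)) d → capDistElem R x k o ≡ d ⊓ suc R
  capDistElem-sound {k = inj₁ _} wp o<7 D = capDist-sound wp (m<n⇒m<1+n o<7) D
  capDistElem-sound {k = inj₂ pq} wp o<7 (_ , _ , Da , Db , refl) =
    capDist-⊓-sound wp (m<n⇒m<1+n o<7) (m<n⇒m<1+n o<7) Da Db
  capDistElem-sound {k = inj₂ pp} wp o<7 (_ , _ , Da , Db , refl) =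
    capDist-⊓-sound wp (m<n⇒m<1+n o<7) (s≤s o<7) Da Db
  capDistElem-sound {k = inj₂ qq} wp o<7 (_ , _ , Da , Db , refl) =
    capDist-⊓-sound wp (m<n⇒m<1+n o<7) (s≤s o<7) Da Db
  capDistElem-sound {k = inj₂ rq} wp o<7 (_ , _ , Da , Db , refl) =
    capDist-⊓-sound wp (m<n⇒m<1+n o<7) (m<n⇒m<1+n o<7) Da Db
  capDistElem-sound {k = inj₂ rq'} wp o<7 (_ , _ , Da , Db , refl) =
    capDist-⊓-sound wp (m<n⇒m<1+n o<7) (s≤s o<7) Da Db
  capDistElem-sound {k = inj₂ rs} wp o<7 (_ , _ , Da , Db , refl) =
    capDist-⊓-sound wp (m<n⇒m<1+n o<7) (m<n⇒m<1+n o<7) Da Db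

  capDist-resolves : ∀ {x R k₁ k₂ o₁ o₂} → WellPlaced x R → o₁ < 7 → o₂ < 7 →
                     capDistElem R x k₁ o₁ ≢ capDistElem R x k₂ o₂ →
                     Resolves ⟦ x ⟧ (element k₁ (shift o₁ b)) (element k₂ (shift o₂ b))
  capDist-resolves {x} {R} {k₁} {k₂} {o₁} {o₂} wp o₁<7 o₂<7 caps≢ =
    resolves {z = ⟦ x ⟧} {element k₁ (shift o₁ b)} {element k₂ (shift o₂ b)} λ D₁ D₂ d₁≡d₂ →
      caps≢ (trans (capDistElem-sound wp o₁<7 D₁)
                   (trans (cong (_⊓ suc R) d₁≡d₂) (sym (capDistElem-sound wp o₂<7 D₂))))

  Far : Fin (suc m) → Set
  Far c = ∀ {o} → o < 7 → c ≢ shift o b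

  outside-s₃-ball : ∀ {k c d} → (∀ {o} → 2 ≤ o → o ≤ 5 → c ≢ shift o b) →
                    Dist ⟦ s , 3 ⟧ (k , c) d → 3 < d
  outside-s₃-ball {d = d} outside (walk , _) with d ≤? 3
  ... | no d≰3 = ≰⇒> d≰3
  ... | yes d≤3 with find (walk-layer (s , 3) d (λ i<d → proj₁ s₃-well-placed (<-≤-trans i<d d≤3)) walk)
  ...   | _ , y∈layer , refl with All.lookup (s₃-ball-window (s≤s d≤3)) y∈layer
  ...     | 2≤o , o≤5 = contradiction refl (outside 2≤o o≤5)

  far-outside : ∀ {c} → Far c → ∀ {o} → 2 ≤ o → o ≤ 5 → c ≢ shift o b
  far-outside far _ o≤5 = far (s≤s (≤-trans o≤5 (m≤m+n 5 1)))

  far-next-outside : ∀ {c} → Far c → ∀ {o} → 2 ≤ o → o ≤ 5 → next c ≢ shift o b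
  far-next-outside far {suc o} _ o<5 = far (≤-trans o<5 (m≤m+n 5 2)) ∘ next-injective

  far-from-s₃ : ∀ {k c d} → Far c → DistElem ⟦ s , 3 ⟧ (element k c) d → 3 < d
  far-from-s₃ {inj₁ _} far D = outside-s₃-ball (far-outside far) D
  far-from-s₃ {inj₂ pq} far (_ , _ , Da , Db , refl) =
    ⊓-glb (outside-s₃-ball (far-outside far) Da) (outside-s₃-ball (far-outside far) Db)
  far-from-s₃ {inj₂ pp} far (_ , _ , Da , Db , refl) =
    ⊓-glb (outside-s₃-ball (far-outside far) Da) (outside-s₃-ball (far-next-outside far) Db)
  far-from-s₃ {inj₂ qq} far (_ , _ , Da , Db , refl) =
    ⊓-glb (outside-s₃-ball (far-outside far) Da) (outside-s₃-ball (far-next-outside far) Db)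
  far-from-s₃ {inj₂ rq} far (_ , _ , Da , Db , refl) =
    ⊓-glb (outside-s₃-ball (far-outside far) Da) (outside-s₃-ball (far-outside far) Db)
  far-from-s₃ {inj₂ rq'} far (_ , _ , Da , Db , refl) =
    ⊓-glb (outside-s₃-ball (far-outside far) Da) (outside-s₃-ball (far-next-outside far) Db)
  far-from-s₃ {inj₂ rs} far (_ , _ , Da , Db , refl) =
    ⊓-glb (outside-s₃-ball (far-outside far) Da) (outside-s₃-ball (far-outside far) Db)

-- Upper bound

M₀ : ∀ m → List (Vertex (suc m))
M₀ m = (p , zero) ∷ sVertices (suc m)

M₀-unique : ∀ m → Unique (M₀ m)
M₀-unique m = All.tabulate p₀≢ ∷ sVertices-unique (suc m)
  where
  p₀≢ : ∀ {v} → v ∈ sVertices (suc m) → (p , zero) ≢ v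
  p₀≢ v∈ refl with sVertices-kind v∈
  ... | ()

length-M₀ : ∀ m → length (M₀ m) ≡ suc (suc m)
length-M₀ m = cong suc (length-sVertices (suc m))

module UpperBound {m : ℕ} (N : ℕ) .{{_ : NonZero N}} (agree : Agrees (suc m) N)
                  (cert : Modulo.Certificate N) where

  open Modulo.Certificate cert

  3<7 : 3 < 7
  3<7 = m≤m+n 4 3

  3<8 : 3 < 8
  3<8 = m≤m+n 4 4

  ResolvedBy : List (Vertex (suc m)) → Elem (suc m) → Elem (suc m) → Set
  ResolvedBy M y₁ y₂ = ∃[ z ] (z ∈ M × Resolves z y₁ y₂)

  module _ (b : Fin (suc m)) where

    open Interpretation b
    open Soundness b N agree

    s∈M₀ : ∀ o → ⟦ s , o ⟧ ∈ M₀ m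
    s∈M₀ o = there (∈-sVertices (shift o b))

    resolve-near : ∀ k₁ k₂ {o} → o < 7 → element k₁ (shift 3 b) ≢ element k₂ (shift o b) →
                   ResolvedBy (M₀ m) (element k₁ (shift 3 b)) (element k₂ (shift o b))
    resolve-near k₁ k₂ {o} o<7 y₁≢y₂ with separated k₁ k₂ o<7
    ... | inj₁ (3≈o , inj₁ refl) = contradiction (cong (element k₁) (shift-≈ 3<8 (m<n⇒m<1+n o<7) 3≈o)) y₁≢y₂
    ... | inj₁ (3≈o , inj₂ (inj₁ (refl , refl))) =
      (p , zero) , here refl ,
      subst (λ i → Resolves (p , zero) (inj₁ (q , shift 3 b)) (inj₂ (pq , i)))
            (shift-≈ 3<8 (m<n⇒m<1+n o<7) 3≈o) (p-resolves-twins zero (shift 3 b))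
    ... | inj₁ (3≈o , inj₂ (inj₂ (refl , refl))) =
      (p , zero) , here refl ,
      subst (λ i → Resolves (p , zero) (inj₂ (pq , shift 3 b)) (inj₁ (q , i)))
            (shift-≈ 3<8 (m<n⇒m<1+n o<7) 3≈o)
            (Resolves-sym {y₁ = inj₁ (q , shift 3 b)} {inj₂ (pq , shift 3 b)}
                          (p-resolves-twins zero (shift 3 b)))
    ... | inj₂ (c , c<5 , caps≢) =
      ⟦ s , suc c ⟧ , s∈M₀ (suc c) , capDist-resolves (centres-well-placed c<5) 3<7 o<7 caps≢

    resolve-far : ∀ k₁ k₂ {c} → Far c → Resolves ⟦ s , 3 ⟧ (element k₁ (shift 3 b)) (element k₂ c)
    resolve-far k₁ k₂ {c} far =
      resolves {z = ⟦ s , 3 ⟧} {element k₁ (shift 3 b)} {element k₂ c} λ D₁ D₂ d₁≡d₂ →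
        <-irrefl d₁≡d₂ (≤-<-trans (d₁≤3 D₁) (far-from-s₃ far D₂))
      where
      d₁≤3 : ∀ {d₁} → DistElem ⟦ s , 3 ⟧ (element k₁ (shift 3 b)) d₁ → d₁ ≤ 3
      d₁≤3 D₁ = ⊓-suc-≤ (subst (_≤ 3) (capDistElem-sound s₃-well-placed 3<7 D₁) (near k₁))

  generates : MixedMetricGenerator (suc m) (M₀ m)
  generates y₁ y₂ y₁≢y₂
    with kindOf y₁ | indexOf y₁ | element-kindOf-indexOf y₁ | kindOf y₂ | indexOf y₂ | element-kindOf-indexOf y₂
  ... | k₁ | i₁ | refl | k₂ | i₂ | refl with shift-surjective 3 i₁
  ...   | b , refl with anyUpTo? (λ o → i₂ Fin.≟ shift o b) 7
  ...     | yes (o , o<7 , refl) = resolve-near b k₁ k₂ o<7 y₁≢y₂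
  ...     | no ¬window = _ , s∈M₀ b 3 , resolve-far b k₁ k₂ (λ o<7 eq → ¬window (_ , o<7 , eq))

M₀-generates : ∀ m → 3 ≤ m → MixedMetricGenerator (suc m) (M₀ m)
M₀-generates 1 (s≤s ())
M₀-generates 2 (s≤s (s≤s ()))
M₀-generates 3 _ = UpperBound.generates 4 (agrees-with-itself 4) (from-yes (Modulo.certificate? 4))
M₀-generates 4 _ = UpperBound.generates 5 (agrees-with-itself 5) (from-yes (Modulo.certificate? 5))
M₀-generates 5 _ = UpperBound.generates 6 (agrees-with-itself 6) (from-yes (Modulo.certificate? 6))
M₀-generates 6 _ = UpperBound.generates 7 (agrees-with-itself 7) (from-yes (Modulo.certificate? 7))
M₀-generates (suc (suc (suc (suc (suc (suc (suc k))))))) _ =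
  UpperBound.generates 8 (agrees-with-8 (m≤m+n 8 k)) (from-yes (Modulo.certificate? 8))

theorem5 : ∀ (n : ℕ) → 4 ≤ n → MixedMetricDim n (suc n)
theorem5 (suc m) (s≤s 3≤m) =
  (M₀ m , M₀-unique m , length-M₀ m , M₀-generates m 3≤m) , λ _ uniq gen → generator-size zero uniq gen
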